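{- Let $\alpha\ge 1$ be an integer and let $R=(x^4-y^4)^{\alpha}(x^4+y^4)(x^8-34x^4y^4+y^8)\in\mathbb{Z}[x,y]$. If for some integer $i$ with $0\le i\le\frac{\alpha+3}{2}$ the coefficient of the monomial $x^{4(\alpha+3-i)}y^{4i}$ in $R$ equals $0$, then $\alpha=2i-3$. -}

module Defs where

open import Data.Nat using (ℕ; zero; suc)
open import Data.Integer using (ℤ; +_; -_; _+_; _*_)
open import Data.List using (List; []; _∷_; map)

-- Univariate polynomials over a coefficient type, as dense coefficient lists
-- (lowest degree first). Bivariate polynomials ℤ[x,y] = (ℤ[y])[x]:
-- an element p : Poly2 is a list whose a-th entry is the polynomial in y
-- multiplying x^a, and the b-th entry of that is the coefficient of x^a y^b.

Poly1 : Set
Poly1 = List ℤ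

add1 : Poly1 → Poly1 → Poly1
add1 [] q = q
add1 (a ∷ p) [] = a ∷ p
add1 (a ∷ p) (b ∷ q) = (a + b) ∷ add1 p q

scale1 : ℤ → Poly1 → Poly1
scale1 c = map (c *_)

mul1 : Poly1 → Poly1 → Poly1
mul1 [] q = []
mul1 (a ∷ p) q = add1 (scale1 a q) (+ 0 ∷ mul1 p q)

Poly2 : Set
Poly2 = List Poly1

add2 : Poly2 → Poly2 → Poly2
add2 [] q = q
add2 (a ∷ p) [] = a ∷ p
add2 (a ∷ p) (b ∷ q) = add1 a b ∷ add2 p q

scale2 : Poly1 → Poly2 → Poly2
scale2 c = map (mul1 c)

mul2 : Poly2 → Poly2 → Poly2
mul2 [] q = []
mul2 (a ∷ p) q = add2 (scale2 a q) ([] ∷ mul2 p q)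

pow2 : Poly2 → ℕ → Poly2
pow2 p zero = (+ 1 ∷ []) ∷ []
pow2 p (suc n) = mul2 p (pow2 p n)

coeff1 : Poly1 → ℕ → ℤ
coeff1 [] _ = + 0
coeff1 (a ∷ p) zero = a
coeff1 (a ∷ p) (suc n) = coeff1 p n

coeff2 : Poly2 → ℕ → ℕ → ℤ
coeff2 [] _ _ = + 0
coeff2 (q ∷ p) zero b = coeff1 q b
coeff2 (q ∷ p) (suc a) b = coeff2 p a b

zeros : {A : Set} → A → ℕ → List A → List A
zeros z zero l = l
zeros z (suc n) l = z ∷ zeros z n l

mono : ℤ → ℕ → ℕ → Poly2
mono c a b = zeros [] a (zeros (+ 0) b (c ∷ []) ∷ [])

f₁ : Poly2
f₁ = add2 (mono (+ 1) 4 0) (mono (- (+ 1)) 0 4)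

f₂ : Poly2
f₂ = add2 (mono (+ 1) 4 0) (mono (+ 1) 0 4)

f₃ : Poly2
f₃ = add2 (mono (+ 1) 8 0) (add2 (mono (- (+ 34)) 4 4) (mono (+ 1) 0 8))

R : ℕ → Poly2
R α = mul2 (pow2 f₁ α) (mul2 f₂ f₃)

module Submission where

-- Writing X = x⁴ and Y = y⁴, we have R α = (X − Y)^α·(X + Y)(X² − 34XY + Y²) and
-- (X + Y)(X² − 34XY + Y²) = X³ − 33X²Y − 33XY² + Y³.  The coefficient of X^n Y^i in R α
-- (n + i = α + 3) is therefore (−1)^k·(A − B) with, for i = 3 + k,
--   A = C(α,k) + 33·C(α,k+1),   B = C(α,k+3) + 33·C(α,k+2),
-- and a degenerate form of the same for i = 0, 1, 2.  When i < n the index k + 2 lies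
-- strictly below the middle α/2, so the binomial coefficients increase there and A < B;
-- the cases i = 0, 1, 2 are direct.  Hence a vanishing coefficient forces n = i.
--
-- Multiplication by a fixed polynomial p is a linear operator that commutes with the
--     shifts "multiply by x" and "multiply by y"; a polynomial written as an expression
--     in monomials acts by shifts and scalings only.

open import Defs

module Binomial where

  open import Data.Nat
  open import Data.Nat.Properties
  open import Data.Nat.Combinatorics using (_C_; nC1≡n; nCk+nC[k+1]≡[n+1]C[k+1])
  open import Data.Nat.Tactic.RingSolver using (solve-∀)
  open import Relation.Binary.PropositionalEquality

  C-absorption : ∀ n k → suc k * (n C suc k) + suc k * (n C k) ≡ suc n * (n C k)
  C-absorption zero zero = refl
  C-absorption zero (suc k) = cong₂ _+_ (*-zeroʳ (2 + k)) (*-zeroʳ (2 + k))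
  C-absorption (suc n) zero = trans (cong (λ c → 1 * c + 1 * 1) (nC1≡n (suc n))) (simplify n)
    where
    simplify : ∀ n → 1 * suc n + 1 * 1 ≡ (2 + n) * 1
    simplify = solve-∀
  C-absorption (suc n) (suc k) = begin
      (2 + k) * (suc n C (2 + k)) + (2 + k) * (suc n C (1 + k))
    ≡⟨ cong₂ (λ u v → (2 + k) * u + (2 + k) * v) (pascal n (1 + k)) (pascal n k) ⟩
      (2 + k) * (B + D) + (2 + k) * (A + B)
    ≡⟨ regroup k A B D ⟩
      ((2 + k) * D + (2 + k) * B) + ((1 + k) * B + (1 + k) * A) + (A + B)
    ≡⟨ cong₂ (λ u v → u + v + (A + B)) (C-absorption n (1 + k)) (C-absorption n k) ⟩
      (1 + n) * B + (1 + n) * A + (A + B)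
    ≡⟨ collect n A B ⟩
      (2 + n) * (A + B)
    ≡⟨ cong ((2 + n) *_) (sym (pascal n k)) ⟩
      (2 + n) * (suc n C (1 + k)) ∎
    where
    open ≡-Reasoning
    A B D : ℕ
    A = n C k
    B = n C suc k
    D = n C suc (suc k)
    pascal : ∀ n k → suc n C suc k ≡ n C k + n C suc k
    pascal n k = sym (nCk+nC[k+1]≡[n+1]C[k+1] n k)
    regroup : ∀ k A B D → (2 + k) * (B + D) + (2 + k) * (A + B)
      ≡ ((2 + k) * D + (2 + k) * B) + ((1 + k) * B + (1 + k) * A) + (A + B)
    regroup = solve-∀
    collect : ∀ n A B → (1 + n) * B + (1 + n) * A + (A + B) ≡ (2 + n) * (A + B)
    collect = solve-∀

  C-ratio : ∀ n j d → j + d ≡ n → suc j * (n C suc j) ≡ d * (n C j)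
  C-ratio n j d j+d≡n = +-cancelʳ-≡ (suc j * (n C j)) _ _ (begin
      suc j * (n C suc j) + suc j * (n C j)
    ≡⟨ C-absorption n j ⟩
      suc n * (n C j)
    ≡⟨ cong (λ m → suc m * (n C j)) (sym j+d≡n) ⟩
      suc (j + d) * (n C j)
    ≡⟨ split j d (n C j) ⟩
      d * (n C j) + suc j * (n C j) ∎)
    where
    open ≡-Reasoning
    split : ∀ j d c → suc (j + d) * c ≡ d * c + suc j * c
    split = solve-∀

  C-pos : ∀ n k → k ≤ n → 0 < n C k
  C-pos n zero _ = s≤s z≤n
  C-pos (suc n) (suc k) (s≤s k≤n) =
    subst (0 <_) (nCk+nC[k+1]≡[n+1]C[k+1] n k) (≤-trans (C-pos n k k≤n) (m≤m+n _ _))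

  low-inequality : ∀ α → 2 ≤ α → 33 < α C 2 + 33 * (α C 1)
  low-inequality α 2≤α = begin-strict
      33                  <⟨ m≤m+n 34 32 ⟩
      33 * 2              ≤⟨ *-monoʳ-≤ 33 2≤α ⟩
      33 * α              ≡⟨ cong (33 *_) (sym (nC1≡n α)) ⟩
      33 * (α C 1)        ≤⟨ m≤n+m _ (α C 2) ⟩
      α C 2 + 33 * (α C 1) ∎
    where open ≤-Reasoning

  -- If α = m + k + 3 with k < m, then C(α,k) + 33·C(α,k+1) < C(α,k+3) + 33·C(α,k+2):
  -- C(α,k) ≤ C(α,k+1) ≤ C(α,k+3), and C(α,k+1) < C(α,k+2) as k+2 lies below the middle.
  central-inequality : ∀ α m k → k < m → m + (3 + k) ≡ α →
    α C k + 33 * (α C (1 + k)) < α C (3 + k) + 33 * (α C (2 + k))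
  central-inequality α m k k<m m+3+k≡α = +-mono-≤-< C₀≤C₃ (*-monoʳ-< 33 C₁<C₂)
    where
    C₀ C₁ C₂ C₃ : ℕ
    C₀ = α C k
    C₁ = α C (1 + k)
    C₂ = α C (2 + k)
    C₃ = α C (3 + k)
    shift₀ : ∀ k m → k + (3 + m) ≡ m + (3 + k)
    shift₀ = solve-∀
    shift₁ : ∀ k m → (1 + k) + (2 + m) ≡ m + (3 + k)
    shift₁ = solve-∀
    shift₂ : ∀ k m → (2 + k) + (1 + m) ≡ m + (3 + k)
    shift₂ = solve-∀
    ratio : ∀ j d → j + d ≡ m + (3 + k) → suc j * (α C suc j) ≡ d * (α C j)
    ratio j d e = C-ratio α j d (trans e m+3+k≡α)
    r₀ : (1 + k) * C₁ ≡ (3 + m) * C₀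
    r₀ = ratio k (3 + m) (shift₀ k m)
    r₁ : (2 + k) * C₂ ≡ (2 + m) * C₁
    r₁ = ratio (1 + k) (2 + m) (shift₁ k m)
    r₂ : (3 + k) * C₃ ≡ (1 + m) * C₂
    r₂ = ratio (2 + k) (1 + m) (shift₂ k m)
    C₁>0 : 0 < C₁
    C₁>0 = C-pos α (1 + k) (subst (1 + k ≤_) (trans (shift₁ k m) m+3+k≡α) (m≤m+n (1 + k) (2 + m)))
    C₀≤C₁ : C₀ ≤ C₁
    C₀≤C₁ = *-cancelˡ-≤ (1 + k) (begin
        (1 + k) * C₀  ≤⟨ *-monoˡ-≤ C₀ (s≤s (≤-trans (<⇒≤ k<m) (m≤n+m m 2))) ⟩
        (3 + m) * C₀  ≡⟨ sym r₀ ⟩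
        (1 + k) * C₁  ∎)
      where open ≤-Reasoning
    C₁<C₂ : C₁ < C₂
    C₁<C₂ = *-cancelˡ-< (2 + k) C₁ C₂ (begin-strict
        (2 + k) * C₁  <⟨ *-monoˡ-< C₁ {{>-nonZero C₁>0}} (s≤s (s≤s k<m)) ⟩
        (2 + m) * C₁  ≡⟨ sym r₁ ⟩
        (2 + k) * C₂  ∎)
      where open ≤-Reasoning
    C₁≤C₃ : C₁ ≤ C₃
    C₁≤C₃ = *-cancelˡ-≤ (3 + k) (begin
        (3 + k) * C₁  ≤⟨ *-monoˡ-≤ C₁ (s≤s (s≤s k<m)) ⟩
        (2 + m) * C₁  ≡⟨ sym r₁ ⟩
        (2 + k) * C₂  ≤⟨ *-monoˡ-≤ C₂ (s≤s k<m) ⟩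
        (1 + m) * C₂  ≡⟨ sym r₂ ⟩
        (3 + k) * C₃  ∎)
      where open ≤-Reasoning
    C₀≤C₃ : C₀ ≤ C₃
    C₀≤C₃ = ≤-trans C₀≤C₁ C₁≤C₃

module Coefficients where

  open import Data.Nat as ℕ using (ℕ; zero; suc)
  import Data.Nat.Properties as ℕ
  open import Data.Nat.Combinatorics using (_C_; nCn≡1; nCk+nC[k+1]≡[n+1]C[k+1])
  open import Data.Integer using (ℤ; +_; -_; _+_; _*_; _-_; -1ℤ; _^_)
  import Data.Integer.Properties as ℤ
  open import Data.Integer.Tactic.RingSolver using (solve-∀)
  open import Data.List using ([]; _∷_)
  open import Data.Sum using (inj₁; inj₂)
  open import Relation.Nullary using (contradiction)
  open import Relation.Binary.PropositionalEquality
  open ≡-Reasoning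

  Coeffs : Set
  Coeffs = ℕ → ℕ → ℤ

  infix 4 _≋_
  _≋_ : Coeffs → Coeffs → Set
  g ≋ h = ∀ a b → g a b ≡ h a b

  infixl 6 _⊞_
  infixr 7 _⊡_

  _⊞_ : Coeffs → Coeffs → Coeffs
  (g ⊞ h) a b = g a b + h a b

  _⊡_ : ℤ → Coeffs → Coeffs
  (c ⊡ g) a b = c * g a b

  δ : Coeffs
  δ zero zero = + 1
  δ zero (suc b) = + 0
  δ (suc a) b = + 0

  shift : (ℕ → ℤ) → ℕ → ℤ
  shift f zero = + 0
  shift f (suc n) = f n

  byX : Coeffs → Coeffs
  byX g zero b = + 0
  byX g (suc a) b = g a b

  byY : Coeffs → Coeffs
  byY g a = shift (g a)

  byXⁿ : ℕ → Coeffs → Coeffs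
  byXⁿ zero g = g
  byXⁿ (suc k) g = byX (byXⁿ k g)

  byYⁿ : ℕ → Coeffs → Coeffs
  byYⁿ zero g = g
  byYⁿ (suc k) g = byY (byYⁿ k g)

  byX-cong : ∀ {g h} → g ≋ h → byX g ≋ byX h
  byX-cong e zero b = refl
  byX-cong e (suc a) b = e a b

  byY-cong : ∀ {g h} → g ≋ h → byY g ≋ byY h
  byY-cong e a zero = refl
  byY-cong e a (suc b) = e a b

  byXⁿ-cong : ∀ k {g h} → g ≋ h → byXⁿ k g ≋ byXⁿ k h
  byXⁿ-cong zero e = e
  byXⁿ-cong (suc k) e = byX-cong (byXⁿ-cong k e)

  byYⁿ-cong : ∀ k {g h} → g ≋ h → byYⁿ k g ≋ byYⁿ k h
  byYⁿ-cong zero e = e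
  byYⁿ-cong (suc k) e = byY-cong (byYⁿ-cong k e)

  mulRow : Poly1 → (ℕ → ℤ) → ℕ → ℤ
  mulRow [] f n = + 0
  mulRow (c ∷ r) f n = c * f n + shift (mulRow r f) n

  mulBy : Poly2 → Coeffs → Coeffs
  mulBy [] g a b = + 0
  mulBy (r ∷ p) g a b = mulRow r (g a) b + byX (mulBy p g) a b

  coeff1-add1 : ∀ p q n → coeff1 (add1 p q) n ≡ coeff1 p n + coeff1 q n
  coeff1-add1 [] q n = sym (ℤ.+-identityˡ _)
  coeff1-add1 (a ∷ p) [] n = sym (ℤ.+-identityʳ _)
  coeff1-add1 (a ∷ p) (b ∷ q) zero = refl
  coeff1-add1 (a ∷ p) (b ∷ q) (suc n) = coeff1-add1 p q n

  coeff1-scale1 : ∀ c q n → coeff1 (scale1 c q) n ≡ c * coeff1 q n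
  coeff1-scale1 c [] n = sym (ℤ.*-zeroʳ c)
  coeff1-scale1 c (a ∷ q) zero = refl
  coeff1-scale1 c (a ∷ q) (suc n) = coeff1-scale1 c q n

  coeff1-mul1 : ∀ r q n → coeff1 (mul1 r q) n ≡ mulRow r (coeff1 q) n
  coeff1-mul1 [] q n = refl
  coeff1-mul1 (c ∷ r) q zero =
    trans (coeff1-add1 (scale1 c q) _ zero) (cong (_+ + 0) (coeff1-scale1 c q zero))
  coeff1-mul1 (c ∷ r) q (suc n) =
    trans (coeff1-add1 (scale1 c q) _ (suc n))
          (cong₂ _+_ (coeff1-scale1 c q (suc n)) (coeff1-mul1 r q n))

  coeff2-add2 : ∀ p q → coeff2 (add2 p q) ≋ coeff2 p ⊞ coeff2 q
  coeff2-add2 [] q a b = sym (ℤ.+-identityˡ _)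
  coeff2-add2 (r ∷ p) [] a b = sym (ℤ.+-identityʳ _)
  coeff2-add2 (r ∷ p) (s ∷ q) zero b = coeff1-add1 r s b
  coeff2-add2 (r ∷ p) (s ∷ q) (suc a) b = coeff2-add2 p q a b

  mulRow-cong : ∀ r {f f′} → (∀ n → f n ≡ f′ n) → ∀ n → mulRow r f n ≡ mulRow r f′ n
  mulRow-cong [] e n = refl
  mulRow-cong (c ∷ r) e zero = cong (λ v → c * v + + 0) (e zero)
  mulRow-cong (c ∷ r) e (suc n) = cong₂ (λ v w → c * v + w) (e (suc n)) (mulRow-cong r e n)

  mulRow-zero : ∀ r n → mulRow r (λ _ → + 0) n ≡ + 0
  mulRow-zero [] n = refl
  mulRow-zero (c ∷ r) zero = cong (_+ + 0) (ℤ.*-zeroʳ c)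
  mulRow-zero (c ∷ r) (suc n) = cong₂ _+_ (ℤ.*-zeroʳ c) (mulRow-zero r n)

  distrib-interchange : ∀ c x y w z → c * (x + y) + (w + z) ≡ (c * x + w) + (c * y + z)
  distrib-interchange = solve-∀

  scale-interchange : ∀ c d x w → c * (d * x) + d * w ≡ d * (c * x + w)
  scale-interchange = solve-∀

  mulRow-+ : ∀ r f f′ n → mulRow r (λ m → f m + f′ m) n ≡ mulRow r f n + mulRow r f′ n
  mulRow-+ [] f f′ n = refl
  mulRow-+ (c ∷ r) f f′ zero = distrib-interchange c (f zero) (f′ zero) (+ 0) (+ 0)
  mulRow-+ (c ∷ r) f f′ (suc n) =
    trans (cong (_+_ (c * (f (suc n) + f′ (suc n)))) (mulRow-+ r f f′ n))
          (distrib-interchange c _ _ _ _)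

  mulRow-⊡ : ∀ r d f n → mulRow r (λ m → d * f m) n ≡ d * mulRow r f n
  mulRow-⊡ [] d f n = sym (ℤ.*-zeroʳ d)
  mulRow-⊡ (c ∷ r) d f zero =
    trans (cong (_+_ (c * (d * f zero))) (sym (ℤ.*-zeroʳ d))) (scale-interchange c d _ _)
  mulRow-⊡ (c ∷ r) d f (suc n) =
    trans (cong (_+_ (c * (d * f (suc n)))) (mulRow-⊡ r d f n)) (scale-interchange c d _ _)

  mulRow-shift : ∀ r f n → mulRow r (shift f) n ≡ shift (mulRow r f) n
  mulRow-shift [] f zero = refl
  mulRow-shift [] f (suc n) = refl
  mulRow-shift (c ∷ r) f zero = cong (_+ + 0) (ℤ.*-zeroʳ c)
  mulRow-shift (c ∷ r) f (suc n) = cong (_+_ (c * f n)) (mulRow-shift r f n)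

  mulRow-one : ∀ r n → mulRow r (δ zero) n ≡ coeff1 r n
  mulRow-one [] n = refl
  mulRow-one (c ∷ r) zero = trans (ℤ.+-identityʳ _) (ℤ.*-identityʳ c)
  mulRow-one (c ∷ r) (suc n) =
    trans (cong₂ _+_ (ℤ.*-zeroʳ c) (mulRow-one r n)) (ℤ.+-identityˡ _)

  coeff2-scale2 : ∀ r Z a b → coeff2 (scale2 r Z) a b ≡ mulRow r (coeff2 Z a) b
  coeff2-scale2 r [] a b = sym (mulRow-zero r b)
  coeff2-scale2 r (q ∷ Z) zero b = coeff1-mul1 r q b
  coeff2-scale2 r (q ∷ Z) (suc a) b = coeff2-scale2 r Z a b

  coeff2-mul2 : ∀ p Z → coeff2 (mul2 p Z) ≋ mulBy p (coeff2 Z)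
  coeff2-mul2 [] Z a b = refl
  coeff2-mul2 (r ∷ p) Z zero b =
    trans (coeff2-add2 (scale2 r Z) _ zero b) (cong (_+ + 0) (coeff2-scale2 r Z zero b))
  coeff2-mul2 (r ∷ p) Z (suc a) b =
    trans (coeff2-add2 (scale2 r Z) _ (suc a) b)
          (cong₂ _+_ (coeff2-scale2 r Z (suc a) b) (coeff2-mul2 p Z a b))

  +-interchange : ∀ x y u v → (x + y) + (u + v) ≡ (x + u) + (y + v)
  +-interchange = solve-∀

  shift-+ : ∀ f f′ n → shift (λ m → f m + f′ m) n ≡ shift f n + shift f′ n
  shift-+ f f′ zero = refl
  shift-+ f f′ (suc n) = refl

  byX-byY : ∀ g → byX (byY g) ≋ byY (byX g)
  byX-byY g zero zero = refl
  byX-byY g zero (suc b) = refl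
  byX-byY g (suc a) b = refl

  mulBy-cong : ∀ p {g h} → g ≋ h → mulBy p g ≋ mulBy p h
  mulBy-cong [] e a b = refl
  mulBy-cong (r ∷ p) e a b =
    cong₂ _+_ (mulRow-cong r (e a) b) (byX-cong (mulBy-cong p e) a b)

  mulBy-⊞ : ∀ p g h → mulBy p (g ⊞ h) ≋ mulBy p g ⊞ mulBy p h
  mulBy-⊞ [] g h a b = refl
  mulBy-⊞ (r ∷ p) g h zero b =
    trans (cong (_+ + 0) (mulRow-+ r (g zero) (h zero) b))
          (+-interchange (mulRow r (g zero) b) (mulRow r (h zero) b) (+ 0) (+ 0))
  mulBy-⊞ (r ∷ p) g h (suc a) b =
    trans (cong₂ _+_ (mulRow-+ r (g (suc a)) (h (suc a)) b) (mulBy-⊞ p g h a b))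
          (+-interchange (mulRow r (g (suc a)) b) (mulRow r (h (suc a)) b) _ _)

  mulBy-⊡ : ∀ p c g → mulBy p (c ⊡ g) ≋ c ⊡ mulBy p g
  mulBy-⊡ [] c g a b = sym (ℤ.*-zeroʳ c)
  mulBy-⊡ (r ∷ p) c g zero b =
    trans (cong₂ _+_ (mulRow-⊡ r c (g zero) b) (sym (ℤ.*-zeroʳ c))) (sym (ℤ.*-distribˡ-+ c _ _))
  mulBy-⊡ (r ∷ p) c g (suc a) b =
    trans (cong₂ _+_ (mulRow-⊡ r c (g (suc a)) b) (mulBy-⊡ p c g a b)) (sym (ℤ.*-distribˡ-+ c _ _))

  mulBy-byX : ∀ p g → mulBy p (byX g) ≋ byX (mulBy p g)
  mulBy-byX [] g zero b = refl
  mulBy-byX [] g (suc a) b = refl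
  mulBy-byX (r ∷ p) g zero b = cong (_+ + 0) (mulRow-zero r b)
  mulBy-byX (r ∷ p) g (suc a) b = cong (_+_ (mulRow r (g a) b)) (mulBy-byX p g a b)

  mulBy-byY : ∀ p g → mulBy p (byY g) ≋ byY (mulBy p g)
  mulBy-byY [] g a zero = refl
  mulBy-byY [] g a (suc b) = refl
  mulBy-byY (r ∷ p) g a b = begin
      mulRow r (shift (g a)) b + byX (mulBy p (byY g)) a b
    ≡⟨ cong₂ _+_ (mulRow-shift r (g a) b) (byX-cong (mulBy-byY p g) a b) ⟩
      shift (mulRow r (g a)) b + byX (byY (mulBy p g)) a b
    ≡⟨ cong (_+_ (shift (mulRow r (g a)) b)) (byX-byY (mulBy p g) a b) ⟩
      shift (mulRow r (g a)) b + shift (byX (mulBy p g) a) b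
    ≡⟨ sym (shift-+ (mulRow r (g a)) (byX (mulBy p g) a) b) ⟩
      byY (mulBy (r ∷ p) g) a b ∎

  mulBy-one : ∀ p → mulBy p δ ≋ coeff2 p
  mulBy-one [] a b = refl
  mulBy-one (r ∷ p) zero b = trans (ℤ.+-identityʳ _) (mulRow-one r b)
  mulBy-one (r ∷ p) (suc a) b =
    trans (cong₂ _+_ (mulRow-zero r b) (mulBy-one p a b)) (ℤ.+-identityˡ _)

  infixl 6 _⊕_
  infixl 7 _⊗_
  data Expr : Set where
    mon : ℤ → ℕ → ℕ → Expr
    _⊕_ _⊗_ : Expr → Expr → Expr

  poly : Expr → Poly2
  poly (mon c a b) = mono c a b
  poly (e ⊕ e′) = add2 (poly e) (poly e′)
  poly (e ⊗ e′) = mul2 (poly e) (poly e′)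

  act : Expr → Coeffs → Coeffs
  act (mon c a b) g = c ⊡ byXⁿ a (byYⁿ b g)
  act (e ⊕ e′) g = act e g ⊞ act e′ g
  act (e ⊗ e′) g = act e′ (act e g)

  act-cong : ∀ e {g h} → g ≋ h → act e g ≋ act e h
  act-cong (mon c a b) eq a′ b′ = cong (c *_) (byXⁿ-cong a (byYⁿ-cong b eq) a′ b′)
  act-cong (e ⊕ e′) eq a b = cong₂ _+_ (act-cong e eq a b) (act-cong e′ eq a b)
  act-cong (e ⊗ e′) eq = act-cong e′ (act-cong e eq)

  mulBy-byXⁿ : ∀ p k g → mulBy p (byXⁿ k g) ≋ byXⁿ k (mulBy p g)
  mulBy-byXⁿ p zero g = λ a b → refl
  mulBy-byXⁿ p (suc k) g a b =
    trans (mulBy-byX p (byXⁿ k g) a b) (byX-cong (mulBy-byXⁿ p k g) a b)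

  mulBy-byYⁿ : ∀ p k g → mulBy p (byYⁿ k g) ≋ byYⁿ k (mulBy p g)
  mulBy-byYⁿ p zero g = λ a b → refl
  mulBy-byYⁿ p (suc k) g a b =
    trans (mulBy-byY p (byYⁿ k g) a b) (byY-cong (mulBy-byYⁿ p k g) a b)

  mulBy-act : ∀ p e g → mulBy p (act e g) ≋ act e (mulBy p g)
  mulBy-act p (mon c k l) g a b = begin
      mulBy p (c ⊡ byXⁿ k (byYⁿ l g)) a b
    ≡⟨ mulBy-⊡ p c _ a b ⟩
      c * mulBy p (byXⁿ k (byYⁿ l g)) a b
    ≡⟨ cong (c *_) (mulBy-byXⁿ p k _ a b) ⟩
      c * byXⁿ k (mulBy p (byYⁿ l g)) a b
    ≡⟨ cong (c *_) (byXⁿ-cong k (mulBy-byYⁿ p l g) a b) ⟩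
      c * byXⁿ k (byYⁿ l (mulBy p g)) a b ∎
  mulBy-act p (e ⊕ e′) g a b =
    trans (mulBy-⊞ p (act e g) (act e′ g) a b)
          (cong₂ _+_ (mulBy-act p e g a b) (mulBy-act p e′ g a b))
  mulBy-act p (e ⊗ e′) g a b =
    trans (mulBy-act p e′ (act e g) a b) (act-cong e′ (mulBy-act p e g) a b)

  coeff2-zeros : ∀ k X → coeff2 (zeros [] k X) ≋ byXⁿ k (coeff2 X)
  coeff2-zeros zero X a b = refl
  coeff2-zeros (suc k) X zero b = refl
  coeff2-zeros (suc k) X (suc a) b = coeff2-zeros k X a b

  byYⁿ-δ-vanishes : ∀ l a n → byYⁿ l δ (suc a) n ≡ + 0
  byYⁿ-δ-vanishes zero a n = refl
  byYⁿ-δ-vanishes (suc l) a zero = refl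
  byYⁿ-δ-vanishes (suc l) a (suc n) = byYⁿ-δ-vanishes l a n

  coeff2-row : ∀ c l → coeff2 (zeros (+ 0) l (c ∷ []) ∷ []) ≋ c ⊡ byYⁿ l δ
  coeff2-row c zero zero zero = sym (ℤ.*-identityʳ c)
  coeff2-row c zero zero (suc n) = sym (ℤ.*-zeroʳ c)
  coeff2-row c (suc l) zero zero = sym (ℤ.*-zeroʳ c)
  coeff2-row c (suc l) zero (suc n) = coeff2-row c l zero n
  coeff2-row c l (suc a) n = sym (trans (cong (c *_) (byYⁿ-δ-vanishes l a n)) (ℤ.*-zeroʳ c))

  byXⁿ-⊡ : ∀ k c g → byXⁿ k (c ⊡ g) ≋ c ⊡ byXⁿ k g
  byXⁿ-⊡ zero c g a b = refl
  byXⁿ-⊡ (suc k) c g zero b = sym (ℤ.*-zeroʳ c)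
  byXⁿ-⊡ (suc k) c g (suc a) b = byXⁿ-⊡ k c g a b

  coeff2-mono : ∀ c k l → coeff2 (mono c k l) ≋ act (mon c k l) δ
  coeff2-mono c k l a b = begin
      coeff2 (zeros [] k (zeros (+ 0) l (c ∷ []) ∷ [])) a b
    ≡⟨ coeff2-zeros k _ a b ⟩
      byXⁿ k (coeff2 (zeros (+ 0) l (c ∷ []) ∷ [])) a b
    ≡⟨ byXⁿ-cong k (coeff2-row c l) a b ⟩
      byXⁿ k (c ⊡ byYⁿ l δ) a b
    ≡⟨ byXⁿ-⊡ k c (byYⁿ l δ) a b ⟩
      c * byXⁿ k (byYⁿ l δ) a b ∎

  coeff2-poly : ∀ e → coeff2 (poly e) ≋ act e δ
  coeff2-poly (mon c k l) = coeff2-mono c k l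
  coeff2-poly (e ⊕ e′) a b =
    trans (coeff2-add2 (poly e) (poly e′) a b) (cong₂ _+_ (coeff2-poly e a b) (coeff2-poly e′ a b))
  coeff2-poly (e ⊗ e′) a b = begin
      coeff2 (mul2 (poly e) (poly e′)) a b
    ≡⟨ coeff2-mul2 (poly e) (poly e′) a b ⟩
      mulBy (poly e) (coeff2 (poly e′)) a b
    ≡⟨ mulBy-cong (poly e) (coeff2-poly e′) a b ⟩
      mulBy (poly e) (act e′ δ) a b
    ≡⟨ mulBy-act (poly e) e′ δ a b ⟩
      act e′ (mulBy (poly e) δ) a b
    ≡⟨ act-cong e′ (λ a′ b′ → trans (mulBy-one (poly e) a′ b′) (coeff2-poly e a′ b′)) a b ⟩
      act e′ (act e δ) a b ∎

  infixr 8 _^ᵉ_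
  _^ᵉ_ : Expr → ℕ → Expr
  e ^ᵉ zero = mon (+ 1) 0 0
  e ^ᵉ suc n = e ⊗ e ^ᵉ n

  poly-^ : ∀ e n → poly (e ^ᵉ n) ≡ pow2 (poly e) n
  poly-^ e zero = refl
  poly-^ e (suc n) = cong (mul2 (poly e)) (poly-^ e n)

  act-^-comm : ∀ e n g → act (e ^ᵉ n) (act e g) ≋ act e (act (e ^ᵉ n) g)
  act-^-comm e zero g a b =
    trans (ℤ.*-identityˡ _) (act-cong e (λ a′ b′ → sym (ℤ.*-identityˡ (g a′ b′))) a b)
  act-^-comm e (suc n) g = act-^-comm e n (act e g)

  byYⁿ-linear : ∀ k c d g h → byYⁿ k (c ⊡ g ⊞ d ⊡ h) ≋ c ⊡ byYⁿ k g ⊞ d ⊡ byYⁿ k h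
  byYⁿ-linear zero c d g h a b = refl
  byYⁿ-linear (suc k) c d g h a zero = sym (cong₂ _+_ (ℤ.*-zeroʳ c) (ℤ.*-zeroʳ d))
  byYⁿ-linear (suc k) c d g h a (suc b) = byYⁿ-linear k c d g h a b

  X-Y X+Y X²-34XY+Y² : Expr
  X-Y = mon (+ 1) 4 0 ⊕ mon (- (+ 1)) 0 4
  X+Y = mon (+ 1) 4 0 ⊕ mon (+ 1) 0 4
  X²-34XY+Y² = mon (+ 1) 8 0 ⊕ (mon (- (+ 34)) 4 4 ⊕ mon (+ 1) 0 8)

  R-expr : ∀ α → R α ≡ poly (X-Y ^ᵉ α ⊗ (X+Y ⊗ X²-34XY+Y²))
  R-expr α = cong (λ P → mul2 P (mul2 f₂ f₃)) (sym (poly-^ X-Y α))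

  infix 9 _⟨_,_⟩
  _⟨_,_⟩ : Coeffs → ℕ → ℕ → ℤ
  g ⟨ s , t ⟩ = g (s ℕ.* 4) (t ℕ.* 4)

  -- Multiplication by (X + Y)(X² − 34XY + Y²) = X³ − 33X²Y − 33XY² + Y³.
  mulG : Coeffs → Coeffs
  mulG = act (X+Y ⊗ X²-34XY+Y²)

  -- Its coefficients in X-degree at least 3 (the terms with a lower power of Y
  -- are read through the shifts byYⁿ, which vanish when that power would be negative).
  mulG-coeff : ∀ g s t → mulG g ⟨ 3 ℕ.+ s , t ⟩ ≡
    g ⟨ s , t ⟩ - + 33 * byYⁿ 4 g ⟨ 1 ℕ.+ s , t ⟩ - + 33 * byYⁿ 8 g ⟨ 2 ℕ.+ s , t ⟩
      + byYⁿ 12 g ⟨ 3 ℕ.+ s , t ⟩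
  mulG-coeff g s t = begin
      + 1 * (+ 1 * x₀ + + 1 * x₁) + (- (+ 34) * byYⁿ 4 h ⟨ 2 ℕ.+ s , t ⟩ + + 1 * byYⁿ 8 h ⟨ 3 ℕ.+ s , t ⟩)
    ≡⟨ cong₂ (λ u v → + 1 * (+ 1 * x₀ + + 1 * x₁) + (- (+ 34) * u + + 1 * v))
             (byYⁿ-linear 4 (+ 1) (+ 1) (byXⁿ 4 g) (byYⁿ 4 g) ((2 ℕ.+ s) ℕ.* 4) (t ℕ.* 4))
             (byYⁿ-linear 8 (+ 1) (+ 1) (byXⁿ 4 g) (byYⁿ 4 g) ((3 ℕ.+ s) ℕ.* 4) (t ℕ.* 4)) ⟩
      + 1 * (+ 1 * x₀ + + 1 * x₁) + (- (+ 34) * (+ 1 * x₁ + + 1 * x₂) + + 1 * (+ 1 * x₂ + + 1 * x₃))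
    ≡⟨ collect x₀ x₁ x₂ x₃ ⟩
      x₀ - + 33 * x₁ - + 33 * x₂ + x₃ ∎
    where
    h : Coeffs
    h = act X+Y g
    x₀ x₁ x₂ x₃ : ℤ
    x₀ = g ⟨ s , t ⟩
    x₁ = byYⁿ 4 g ⟨ 1 ℕ.+ s , t ⟩
    x₂ = byYⁿ 8 g ⟨ 2 ℕ.+ s , t ⟩
    x₃ = byYⁿ 12 g ⟨ 3 ℕ.+ s , t ⟩
    collect : ∀ x₀ x₁ x₂ x₃ →
      + 1 * (+ 1 * x₀ + + 1 * x₁) + (- (+ 34) * (+ 1 * x₁ + + 1 * x₂) + + 1 * (+ 1 * x₂ + + 1 * x₃))
        ≡ x₀ - + 33 * x₁ - + 33 * x₂ + x₃
    collect = solve-∀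

  sgn : ℕ → ℤ
  sgn t = -1ℤ ^ t

  sgn-cancel : ∀ t D → sgn t * D ≡ + 0 → D ≡ + 0
  sgn-cancel t D h with ℤ.i*j≡0⇒i≡0∨j≡0 (sgn t) h
  ... | inj₁ sgn≡0 = contradiction (ℤ.i^n≡0⇒i≡0 -1ℤ t sgn≡0) (λ ())
  ... | inj₂ D≡0 = D≡0

  binom : ℕ → Coeffs
  binom α = act (X-Y ^ᵉ α) δ

  binom-step : ∀ α → binom (suc α) ≋ act X-Y (binom α)
  binom-step α = act-^-comm X-Y α δ

  binom-coeff : ∀ α s t → s ℕ.+ t ≡ α → binom α ⟨ s , t ⟩ ≡ sgn t * + (α C t)
  binom-coeff zero zero zero refl = refl
  binom-coeff (suc α) zero (suc .α) refl = begin
      binom (suc α) ⟨ 0 , suc α ⟩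
    ≡⟨ binom-step α 0 (suc α ℕ.* 4) ⟩
      + 0 + - (+ 1) * binom α ⟨ 0 , α ⟩
    ≡⟨ cong (λ v → + 0 + - (+ 1) * v) (binom-coeff α 0 α refl) ⟩
      + 0 + - (+ 1) * (sgn α * + (α C α))
    ≡⟨ cong (λ c → + 0 + - (+ 1) * (sgn α * + c)) (nCn≡1 α) ⟩
      + 0 + - (+ 1) * (sgn α * + 1)
    ≡⟨ flip-sign (sgn α) ⟩
      sgn (suc α) * + 1
    ≡⟨ cong (λ c → sgn (suc α) * + c) (sym (nCn≡1 (suc α))) ⟩
      sgn (suc α) * + (suc α C suc α) ∎
    where
    flip-sign : ∀ ε → + 0 + - (+ 1) * (ε * + 1) ≡ -1ℤ * ε * + 1
    flip-sign = solve-∀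
  binom-coeff (suc α) (suc s) zero e = trans (binom-step α _ 0)
    (cong (λ v → + 1 * v + + 0) (binom-coeff α s 0 (ℕ.suc-injective e)))
  binom-coeff (suc α) (suc s) (suc t) e = begin
      binom (suc α) ⟨ suc s , suc t ⟩
    ≡⟨ binom-step α _ _ ⟩
      + 1 * binom α ⟨ s , suc t ⟩ + - (+ 1) * binom α ⟨ suc s , t ⟩
    ≡⟨ cong₂ (λ u v → + 1 * u + - (+ 1) * v) (binom-coeff α s (suc t) s+1+t≡α)
             (binom-coeff α (suc s) t (trans (sym (ℕ.+-suc s t)) s+1+t≡α)) ⟩
      + 1 * (sgn (suc t) * + (α C suc t)) + - (+ 1) * (sgn t * + (α C t))
    ≡⟨ pascal-signs (sgn t) (+ (α C t)) (+ (α C suc t)) ⟩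
      sgn (suc t) * (+ (α C t) + + (α C suc t))
    ≡⟨ cong (sgn (suc t) *_) (trans (sym (ℤ.pos-+ (α C t) _)) (cong +_ (nCk+nC[k+1]≡[n+1]C[k+1] α t))) ⟩
      sgn (suc t) * + (suc α C suc t) ∎
    where
    s+1+t≡α : s ℕ.+ suc t ≡ α
    s+1+t≡α = ℕ.suc-injective e
    pascal-signs : ∀ ε x y → + 1 * (-1ℤ * ε * y) + - (+ 1) * (ε * x) ≡ -1ℤ * ε * (x + y)
    pascal-signs = solve-∀

  binom-line : ∀ α s j t → s ℕ.+ (j ℕ.+ t) ≡ α → binom α ⟨ j ℕ.+ s , t ⟩ ≡ sgn t * + (α C t)
  binom-line α s j t e =
    binom-coeff α (j ℕ.+ s) t (trans (cong (ℕ._+ t) (ℕ.+-comm j s)) (trans (ℕ.+-assoc s j t) e))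

  coeff2-R : ∀ α → coeff2 (R α) ≋ mulG (binom α)
  coeff2-R α a b =
    trans (cong (λ P → coeff2 P a b) (R-expr α)) (coeff2-poly (X-Y ^ᵉ α ⊗ (X+Y ⊗ X²-34XY+Y²)) a b)

  pos-lin : ∀ a b → + (a ℕ.+ 33 ℕ.* b) ≡ + a + + 33 * + b
  pos-lin a b = trans (ℤ.pos-+ a (33 ℕ.* b)) (cong (_+_ (+ a)) (ℤ.pos-* 33 b))

  sgn-diff-vanishes : ∀ t A B → sgn t * (+ A - + B) ≡ + 0 → A ≡ B
  sgn-diff-vanishes t A B h = ℤ.+-injective (ℤ.i-j≡0⇒i≡j (+ A) (+ B) (sgn-cancel t _ h))

  R-coeff₀ : ∀ α s → s ℕ.+ 0 ≡ α → mulG (binom α) ⟨ 3 ℕ.+ s , 0 ⟩ ≡ + 1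
  R-coeff₀ α s e = trans (mulG-coeff (binom α) s 0)
    (cong (λ v → v - + 33 * + 0 - + 33 * + 0 + + 0) (binom-line α s 0 0 e))

  R-coeff₁ : ∀ α s → s ℕ.+ 1 ≡ α →
    mulG (binom α) ⟨ 3 ℕ.+ s , 1 ⟩ ≡ sgn 1 * (+ (33 ℕ.+ α C 1) - + 0)
  R-coeff₁ α s e = begin
      mulG (binom α) ⟨ 3 ℕ.+ s , 1 ⟩
    ≡⟨ mulG-coeff (binom α) s 1 ⟩
      binom α ⟨ s , 1 ⟩ - + 33 * binom α ⟨ 1 ℕ.+ s , 0 ⟩ - + 33 * + 0 + + 0
    ≡⟨ cong₂ (λ u v → u - + 33 * v - + 33 * + 0 + + 0) (binom-line α s 0 1 e) (binom-line α s 1 0 e) ⟩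
      sgn 1 * + (α C 1) - + 33 * (sgn 0 * + (α C 0)) - + 33 * + 0 + + 0
    ≡⟨ collect (+ (α C 1)) ⟩
      sgn 1 * (+ 33 + + (α C 1) - + 0)
    ≡⟨ cong (λ v → sgn 1 * (v - + 0)) (sym (ℤ.pos-+ 33 (α C 1))) ⟩
      sgn 1 * (+ (33 ℕ.+ α C 1) - + 0) ∎
    where
    collect : ∀ c₁ → sgn 1 * c₁ - + 33 * (sgn 0 * + 1) - + 33 * + 0 + + 0 ≡ sgn 1 * (+ 33 + c₁ - + 0)
    collect = solve-∀

  R-coeff₂ : ∀ α s → s ℕ.+ 2 ≡ α →
    mulG (binom α) ⟨ 3 ℕ.+ s , 2 ⟩ ≡ sgn 0 * (+ (α C 2 ℕ.+ 33 ℕ.* (α C 1)) - + 33)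
  R-coeff₂ α s e = begin
      mulG (binom α) ⟨ 3 ℕ.+ s , 2 ⟩
    ≡⟨ mulG-coeff (binom α) s 2 ⟩
      binom α ⟨ s , 2 ⟩ - + 33 * binom α ⟨ 1 ℕ.+ s , 1 ⟩ - + 33 * binom α ⟨ 2 ℕ.+ s , 0 ⟩ + + 0
    ≡⟨ cong₂ (λ u v → u - v + + 0)
         (cong₂ (λ u v → u - + 33 * v) (binom-line α s 0 2 e) (binom-line α s 1 1 e))
         (cong (+ 33 *_) (binom-line α s 2 0 e)) ⟩
      sgn 2 * + (α C 2) - + 33 * (sgn 1 * + (α C 1)) - + 33 * (sgn 0 * + 1) + + 0
    ≡⟨ collect (+ (α C 2)) (+ (α C 1)) ⟩
      sgn 0 * (+ (α C 2) + + 33 * + (α C 1) - + 33)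
    ≡⟨ cong (λ v → sgn 0 * (v - + 33)) (sym (pos-lin (α C 2) (α C 1))) ⟩
      sgn 0 * (+ (α C 2 ℕ.+ 33 ℕ.* (α C 1)) - + 33) ∎
    where
    collect : ∀ c₂ c₁ → sgn 2 * c₂ - + 33 * (sgn 1 * c₁) - + 33 * (sgn 0 * + 1) + + 0
      ≡ sgn 0 * (c₂ + + 33 * c₁ - + 33)
    collect = solve-∀

  R-coeff₃ : ∀ α s k → s ℕ.+ (3 ℕ.+ k) ≡ α →
    mulG (binom α) ⟨ 3 ℕ.+ s , 3 ℕ.+ k ⟩ ≡
      sgn k * (+ (α C k ℕ.+ 33 ℕ.* (α C (1 ℕ.+ k))) - + (α C (3 ℕ.+ k) ℕ.+ 33 ℕ.* (α C (2 ℕ.+ k))))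
  R-coeff₃ α s k e = begin
      mulG (binom α) ⟨ 3 ℕ.+ s , 3 ℕ.+ k ⟩
    ≡⟨ mulG-coeff (binom α) s (3 ℕ.+ k) ⟩
      binom α ⟨ s , 3 ℕ.+ k ⟩ - + 33 * binom α ⟨ 1 ℕ.+ s , 2 ℕ.+ k ⟩
        - + 33 * binom α ⟨ 2 ℕ.+ s , 1 ℕ.+ k ⟩ + binom α ⟨ 3 ℕ.+ s , k ⟩
    ≡⟨ cong₂ (λ u v → u - + 33 * v + binom α ⟨ 3 ℕ.+ s , k ⟩)
         (cong₂ (λ u v → u - + 33 * v) (binom-line α s 0 (3 ℕ.+ k) e) (binom-line α s 1 (2 ℕ.+ k) e))
         (binom-line α s 2 (1 ℕ.+ k) e) ⟩
      sgn (3 ℕ.+ k) * c₃ - + 33 * (sgn (2 ℕ.+ k) * c₂) - + 33 * (sgn (1 ℕ.+ k) * c₁)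
        + binom α ⟨ 3 ℕ.+ s , k ⟩
    ≡⟨ cong (_+_ (sgn (3 ℕ.+ k) * c₃ - + 33 * (sgn (2 ℕ.+ k) * c₂) - + 33 * (sgn (1 ℕ.+ k) * c₁)))
         (binom-line α s 3 k e) ⟩
      sgn (3 ℕ.+ k) * c₃ - + 33 * (sgn (2 ℕ.+ k) * c₂) - + 33 * (sgn (1 ℕ.+ k) * c₁) + sgn k * c₀
    ≡⟨ collect (sgn k) c₀ c₁ c₂ c₃ ⟩
      sgn k * ((c₀ + + 33 * c₁) - (c₃ + + 33 * c₂))
    ≡⟨ cong₂ (λ u v → sgn k * (u - v))
         (sym (pos-lin (α C k) (α C (1 ℕ.+ k)))) (sym (pos-lin (α C (3 ℕ.+ k)) (α C (2 ℕ.+ k)))) ⟩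
      sgn k * (+ (α C k ℕ.+ 33 ℕ.* (α C (1 ℕ.+ k))) - + (α C (3 ℕ.+ k) ℕ.+ 33 ℕ.* (α C (2 ℕ.+ k)))) ∎
    where
    c₀ c₁ c₂ c₃ : ℤ
    c₀ = + (α C k)
    c₁ = + (α C (1 ℕ.+ k))
    c₂ = + (α C (2 ℕ.+ k))
    c₃ = + (α C (3 ℕ.+ k))
    collect : ∀ ε c₀ c₁ c₂ c₃ →
      -1ℤ * (-1ℤ * (-1ℤ * ε)) * c₃ - + 33 * (-1ℤ * (-1ℤ * ε) * c₂) - + 33 * (-1ℤ * ε * c₁) + ε * c₀
        ≡ ε * ((c₀ + + 33 * c₁) - (c₃ + + 33 * c₂))
    collect = solve-∀

open Binomial
open Coefficients
open import Data.Nat using (ℕ; suc; _+_; _*_; _∸_; _≤_; s≤s)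
open import Data.Nat.Properties
open import Data.Integer using (+_)
open import Data.Empty using (⊥-elim)
open import Data.Sum using (inj₁; inj₂)
open import Relation.Binary.PropositionalEquality

high-degree-balanced : ∀ α s i → i ≤ 3 + s → s + i ≡ α →
  mulG (binom α) ⟨ 3 + s , i ⟩ ≡ + 0 → 3 + s ≡ i
high-degree-balanced α s 0 _ e h = ⊥-elim (+1≢+0 (trans (sym (R-coeff₀ α s e)) h))
  where
  +1≢+0 : + 1 ≢ + 0
  +1≢+0 ()
high-degree-balanced α s 1 _ e h =
  ⊥-elim (1+n≢0 (sgn-diff-vanishes 1 _ 0 (trans (sym (R-coeff₁ α s e)) h)))
high-degree-balanced α s 2 _ e h =
  ⊥-elim (<⇒≢ (low-inequality α (subst (2 ≤_) e (m≤n+m 2 s)))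
              (sym (sgn-diff-vanishes 0 _ 33 (trans (sym (R-coeff₂ α s e)) h))))
high-degree-balanced α s (suc (suc (suc k))) (s≤s (s≤s (s≤s k≤s))) e h with m≤n⇒m<n∨m≡n k≤s
... | inj₁ k<s = ⊥-elim (<⇒≢ (central-inequality α s k k<s e)
                              (sgn-diff-vanishes k _ _ (trans (sym (R-coeff₃ α s k e)) h)))
... | inj₂ k≡s = cong (λ m → 3 + m) (sym k≡s)

-- For n + i = 3 + α with i ≤ n and α ≥ 1, the coefficient of X^n Y^i in R α
-- vanishes only if n = i.  Below x-degree 3 only n = i = 2 is compatible with α ≥ 1.
balanced : ∀ α n i → 1 ≤ α → i ≤ n → n + i ≡ 3 + α → mulG (binom α) ⟨ n , i ⟩ ≡ + 0 → n ≡ i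
balanced α 0 0 _ _ () _
balanced α 0 (suc i) _ () _ _
balanced α 1 0 _ _ () _
balanced α 1 1 _ _ () _
balanced α 1 (suc (suc i)) _ (s≤s ()) _ _
balanced α 2 0 _ _ () _
balanced .0 2 1 () _ refl _
balanced α 2 2 _ _ _ _ = refl
balanced α 2 (suc (suc (suc i))) _ (s≤s (s≤s ())) _ _
balanced α (suc (suc (suc s))) i _ i≤n e h =
  high-degree-balanced α s i i≤n (+-cancelˡ-≡ 3 (s + i) α e) h

lemma2p7 : (α i : ℕ) → 1 ≤ α → 2 * i ≤ α + 3 →
    coeff2 (R α) (4 * (α + 3 ∸ i)) (4 * i) ≡ + 0 →
    α + 3 ≡ 2 * i
lemma2p7 α i 1≤α 2i≤α+3 vanishes = begin
    α + 3  ≡⟨ sym n+i≡α+3 ⟩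
    n + i  ≡⟨ cong (_+ i) n≡i ⟩
    i + i  ≡⟨ cong (λ m → i + m) (sym (+-identityʳ i)) ⟩
    2 * i  ∎
  where
  open ≡-Reasoning
  n : ℕ
  n = α + 3 ∸ i
  n+i≡α+3 : n + i ≡ α + 3
  n+i≡α+3 = m∸n+n≡m (≤-trans (m≤m+n i (i + 0)) 2i≤α+3)
  i≤n : i ≤ n
  i≤n = +-cancelʳ-≤ i i n (subst₂ _≤_ (cong (λ m → i + m) (+-identityʳ i)) (sym n+i≡α+3) 2i≤α+3)
  coefficient-vanishes : mulG (binom α) ⟨ n , i ⟩ ≡ + 0
  coefficient-vanishes = trans (sym (coeff2-R α (n * 4) (i * 4)))
    (subst₂ (λ a b → coeff2 (R α) a b ≡ + 0) (*-comm 4 n) (*-comm 4 i) vanishes)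
  n≡i : n ≡ i
  n≡i = balanced α n i 1≤α i≤n (trans n+i≡α+3 (+-comm α 3)) coefficient-vanishes
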